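{- In the Weyl group of type $E_8$, if $r,t$ are reflections with $r\in D(t)$, then $r\preceq t$.
   Context: $W$ acts with root system of type $E_8$ and a fixed set of simple roots; each reflection $t$ has positive root $\alpha_t$; $r\preceq t$ iff $\alpha_t-\alpha_r$ is a nonnegative linear combination of simple roots. $D(t)=\{r\in T: tr<t\}$ in Bruhat order. -}

module Defs where

open import Data.Nat using (ℕ; zero; suc)
import Data.Nat as ℕ
open import Data.Integer using (ℤ; +_; -[1+_]; _+_; _-_; _*_; 0ℤ; 1ℤ; -1ℤ; _≤_; _<_)
import Data.Integer as ℤ
open import Data.Fin using (Fin; zero; suc)
open import Data.Vec using (Vec; []; _∷_; lookup; tabulate; zipWith; foldr)
import Data.Vec.Properties as VecP
open import Data.List using (List; []; _∷_; concatMap; deduplicate; length; filterᵇ; concat; allFin)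
import Data.List as List
open import Data.List.Membership.Propositional using (_∈_)
open import Data.Bool using (Bool; true; false; _∨_; if_then_else_)
open import Data.Product using (Σ; _,_; proj₁)
open import Relation.Nullary.Decidable using (⌊_⌋)
open import Relation.Binary.PropositionalEquality using (_≡_)

-- Vectors in the root lattice, written in the basis of simple roots α₁,…,α₈
-- (Bourbaki labelling: chain 1-3-4-5-6-7-8, node 2 attached to node 4).
V : Set
V = Vec ℤ 8

-- Cartan matrix of E₈ (symmetric; it is the Gram matrix (αᵢ,αⱼ) with (α,α) = 2).
cartan : Vec (Vec ℤ 8) 8
cartan =
  ( + 2 ∷ 0ℤ  ∷ -1ℤ ∷ 0ℤ  ∷ 0ℤ  ∷ 0ℤ  ∷ 0ℤ  ∷ 0ℤ  ∷ []) ∷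
  ( 0ℤ  ∷ + 2 ∷ 0ℤ  ∷ -1ℤ ∷ 0ℤ  ∷ 0ℤ  ∷ 0ℤ  ∷ 0ℤ  ∷ []) ∷
  ( -1ℤ ∷ 0ℤ  ∷ + 2 ∷ -1ℤ ∷ 0ℤ  ∷ 0ℤ  ∷ 0ℤ  ∷ 0ℤ  ∷ []) ∷
  ( 0ℤ  ∷ -1ℤ ∷ -1ℤ ∷ + 2 ∷ -1ℤ ∷ 0ℤ  ∷ 0ℤ  ∷ 0ℤ  ∷ []) ∷
  ( 0ℤ  ∷ 0ℤ  ∷ 0ℤ  ∷ -1ℤ ∷ + 2 ∷ -1ℤ ∷ 0ℤ  ∷ 0ℤ  ∷ []) ∷
  ( 0ℤ  ∷ 0ℤ  ∷ 0ℤ  ∷ 0ℤ  ∷ -1ℤ ∷ + 2 ∷ -1ℤ ∷ 0ℤ  ∷ []) ∷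
  ( 0ℤ  ∷ 0ℤ  ∷ 0ℤ  ∷ 0ℤ  ∷ 0ℤ  ∷ -1ℤ ∷ + 2 ∷ -1ℤ ∷ []) ∷
  ( 0ℤ  ∷ 0ℤ  ∷ 0ℤ  ∷ 0ℤ  ∷ 0ℤ  ∷ 0ℤ  ∷ -1ℤ ∷ + 2 ∷ []) ∷ []

sumV : ∀ {n} → Vec ℤ n → ℤ
sumV = foldr _ _+_ 0ℤ

dot : V → V → ℤ
dot x y = sumV (zipWith _*_ x y)

form : V → V → ℤ
form x y = dot x (tabulate λ i → dot (lookup cartan i) y)

addV : V → V → V
addV = zipWith _+_

scale : ℤ → V → V
scale c = Data.Vec.map (c *_)

subV : V → V → V
subV x y = zipWith _-_ x y

e : Fin 8 → V
e i = tabulate λ j → if ⌊ Data.Fin._≟_ i j ⌋ then 1ℤ else 0ℤ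

_≟V_ : (x y : V) → Relation.Nullary.Decidable.Dec (x ≡ y)
_≟V_ = VecP.≡-dec ℤ._≟_

-- Positive roots, generated by height: level 1 = simple roots; a root of
-- height h+1 is β + αᵢ with β of height h and (β, αᵢ) = -1.
nextLevel : List V → List V
nextLevel βs = deduplicate _≟V_
  (concatMap (λ β → concatMap (λ i → if ⌊ form β (e i) ℤ.≟ -1ℤ ⌋ then addV β (e i) ∷ [] else []) (allFin 8)) βs)

levels : ℕ → List V → List (List V)
levels zero    βs = βs ∷ []
levels (suc n) βs = βs ∷ levels n (nextLevel βs)

-- the positive roots Φ⁺ of E₈ (heights 1..30 explored; the highest root has height 29)
posRoots : List V
posRoots = concat (levels 30 (List.map e (allFin 8)))

-- The set T of reflections, identified with positive roots: t ↦ α_t.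
Refl : Set
Refl = Σ V (λ α → α ∈ posRoots)

-- Elements of GL(root lattice) as 8×8 integer matrices (columns = images of αⱼ).
Mat : Set
Mat = Vec V 8

apply : Mat → V → V
apply M v = foldr _ addV (Data.Vec.replicate 8 0ℤ) (zipWith scale v M)

_·_ : Mat → Mat → Mat
M · N = Data.Vec.map (apply M) N

sref : V → V → V
sref α v = subV v (scale (form v α) α)

reflMat : V → Mat
reflMat α = tabulate λ j → sref α (e j)

reflOf : Refl → Mat
reflOf r = reflMat (proj₁ r)

-- negative vector: some coordinate < 0 (images of roots are roots, hence
-- entirely nonnegative or nonpositive)
isNeg : V → Bool
isNeg v = foldr _ (λ x b → ⌊ x ℤ.<? 0ℤ ⌋ ∨ b) false v

ℓ : Mat → ℕ
ℓ w = length (filterᵇ (λ β → isNeg (apply w β)) posRoots)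

data _<B_ : Mat → Mat → Set where
  step  : ∀ u β → β ∈ posRoots → ℓ u ℕ.< ℓ (u · reflMat β) → u <B (u · reflMat β)
  trans : ∀ {u v w} → u <B v → v <B w → u <B w

InD : Refl → Refl → Set
InD r t = (reflOf t · reflOf r) <B reflOf t

_⪯_ : Refl → Refl → Set
r ⪯ t = ∀ (i : Fin 8) → 0ℤ ≤ lookup (subV (proj₁ t) (proj₁ r)) i

-- Let t = s_α and r = s_γ.  A Bruhat step raises length, so r ∈ D(t) gives ℓ(s_α s_γ) < ℓ(s_α).
-- As an involution, s_γ maps its inversion set N(s_γ) = {β > 0 : s_γ β < 0} onto −N(s_γ)
-- and fixes the sign of every other positive root; hence ℓ(s_α s_γ) = |N(s_α) Δ N(s_γ)|.
-- The theorem thus becomes a statement about the 120 inversion sets of E₈: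
-- |N(s_α) Δ N(s_γ)| < |N(s_α)| forces α − γ ≥ 0.  That statement, and the facts about the
-- action of s_γ on Φ⁺ used above, are verified by evaluation.
module Submission where

open import Defs
open import Data.Bool using (Bool; true; false; not; _∧_; _∨_; _xor_; if_then_else_; T)
open import Data.Bool.ListAction using (all)
open import Data.Bool.Properties using (T-≡; T-∧)
open import Data.Integer using (ℤ; _+_; _-_; _*_; 0ℤ; 1ℤ; -1ℤ; _≤_; _≤?_)
open import Data.Integer.Tactic.RingSolver using (solve-∀)
import Data.Integer.Properties as ℤ
open import Data.List as List using (List; []; _∷_; length; filterᵇ; zipWith)
open import Data.List.Membership.Propositional using (_∈_)
open import Data.List.Membership.Propositional.Properties using (∈-map⁺)
open import Data.List.Relation.Unary.Any using (here; there)
import Data.List.Relation.Unary.All as ListAll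
open import Data.List.Relation.Unary.All.Properties using (all⁺)
open import Data.List.Relation.Binary.Permutation.Propositional as ↭ using (_↭_)
open import Data.List.Relation.Binary.Permutation.Propositional.Properties using (↭-length; filter-↭)
open import Data.Maybe as Maybe using (Maybe; just; nothing; maybe)
open import Data.Nat using (ℕ; zero; suc; _<_; _<ᵇ_)
import Data.Nat.Properties as ℕ
open import Data.Product using (_×_; _,_; proj₁; proj₂)
open import Data.Vec as Vec using (Vec; []; _∷_; tabulate; replicate)
import Data.Vec.Properties as Vec
open import Data.Vec.Relation.Unary.All using (All; all?)
open import Data.Vec.Relation.Unary.All.Properties using (lookup⁺)
open import Function using (_∘_; id; Equivalence)
open import Relation.Binary.Definitions using (DecidableEquality)
open import Relation.Binary.PropositionalEquality
  using (_≡_; refl; sym; cong; cong₂; subst₂; module ≡-Reasoning)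
  renaming (trans to ≡-trans)
open import Relation.Nullary.Decidable using (yes; no; does; ⌊_⌋; toWitness; T?)

open ≡-Reasoning

private
  variable
    A : Set
    m n : ℕ

infixl 6 _+ᵛ_ _-ᵛ_
infixr 7 _*ᵛ_
infix  8 _∙_

_+ᵛ_ _-ᵛ_ : Vec ℤ n → Vec ℤ n → Vec ℤ n
_+ᵛ_ = Vec.zipWith _+_
_-ᵛ_ = Vec.zipWith _-_

_*ᵛ_ : ℤ → Vec ℤ n → Vec ℤ n
c *ᵛ x = Vec.map (c *_) x

0ᵛ : Vec ℤ n
0ᵛ = replicate _ 0ℤ

_∙_ : Vec ℤ n → Vec ℤ n → ℤ
x ∙ y = sumV (Vec.zipWith _*_ x y)

+ᵛ-identityˡ : (x : Vec ℤ n) → 0ᵛ +ᵛ x ≡ x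
+ᵛ-identityˡ []       = refl
+ᵛ-identityˡ (x ∷ xs) = cong₂ _∷_ (ℤ.+-identityˡ x) (+ᵛ-identityˡ xs)

*ᵛ-zeroˡ : (x : Vec ℤ n) → 0ℤ *ᵛ x ≡ 0ᵛ
*ᵛ-zeroˡ []       = refl
*ᵛ-zeroˡ (x ∷ xs) = cong₂ _∷_ (ℤ.*-zeroˡ x) (*ᵛ-zeroˡ xs)

*ᵛ-zeroʳ : ∀ c → c *ᵛ 0ᵛ {n} ≡ 0ᵛ
*ᵛ-zeroʳ {zero}  c = refl
*ᵛ-zeroʳ {suc n} c = cong₂ _∷_ (ℤ.*-zeroʳ c) (*ᵛ-zeroʳ c)

∙-distribʳ-+ᵛ : (x y z : Vec ℤ n) → (x +ᵛ y) ∙ z ≡ x ∙ z + y ∙ z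
∙-distribʳ-+ᵛ []       []       []       = refl
∙-distribʳ-+ᵛ (x ∷ xs) (y ∷ ys) (z ∷ zs)
  rewrite ∙-distribʳ-+ᵛ xs ys zs = interchange x y z (xs ∙ zs) (ys ∙ zs)
  where
  interchange : ∀ x y z a b → (x + y) * z + (a + b) ≡ (x * z + a) + (y * z + b)
  interchange = solve-∀

∙-*ᵛˡ : ∀ c (x z : Vec ℤ n) → (c *ᵛ x) ∙ z ≡ c * (x ∙ z)
∙-*ᵛˡ c []       []       = sym (ℤ.*-zeroʳ c)
∙-*ᵛˡ c (x ∷ xs) (z ∷ zs)
  rewrite ∙-*ᵛˡ c xs zs = factor c x z (xs ∙ zs)
  where
  factor : ∀ c x z a → (c * x) * z + c * a ≡ c * (x * z + a)
  factor = solve-∀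

-ᵛ-*ᵛ-distribʳ-+ : ∀ p q (x y a : Vec ℤ n) →
                   (x +ᵛ y) -ᵛ (p + q) *ᵛ a ≡ (x -ᵛ p *ᵛ a) +ᵛ (y -ᵛ q *ᵛ a)
-ᵛ-*ᵛ-distribʳ-+ p q []       []       []       = refl
-ᵛ-*ᵛ-distribʳ-+ p q (x ∷ xs) (y ∷ ys) (a ∷ as) =
  cong₂ _∷_ (distrib p q x y a) (-ᵛ-*ᵛ-distribʳ-+ p q xs ys as)
  where
  distrib : ∀ p q x y a → (x + y) - (p + q) * a ≡ (x - p * a) + (y - q * a)
  distrib = solve-∀

-ᵛ-*ᵛ-factor : ∀ c p (x a : Vec ℤ n) → c *ᵛ x -ᵛ (c * p) *ᵛ a ≡ c *ᵛ (x -ᵛ p *ᵛ a)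
-ᵛ-*ᵛ-factor c p []       []       = refl
-ᵛ-*ᵛ-factor c p (x ∷ xs) (a ∷ as) =
  cong₂ _∷_ (factor c p x a) (-ᵛ-*ᵛ-factor c p xs as)
  where
  factor : ∀ c p x a → c * x - (c * p) * a ≡ c * (x - p * a)
  factor = solve-∀

record IsLinear (L : Vec ℤ m → Vec ℤ n) : Set where
  field
    additive    : ∀ x y → L (x +ᵛ y) ≡ L x +ᵛ L y
    homogeneous : ∀ c x → L (c *ᵛ x) ≡ c *ᵛ L x

  preserves-0ᵛ : L 0ᵛ ≡ 0ᵛ
  preserves-0ᵛ = begin
    L 0ᵛ            ≡⟨ cong L (sym (*ᵛ-zeroˡ 0ᵛ)) ⟩
    L (0ℤ *ᵛ 0ᵛ)    ≡⟨ homogeneous 0ℤ 0ᵛ ⟩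
    0ℤ *ᵛ L 0ᵛ      ≡⟨ *ᵛ-zeroˡ (L 0ᵛ) ⟩
    0ᵛ              ∎

-- Defs' `apply` is lincomb at m = n = 8.
lincomb : Vec (Vec ℤ m) n → Vec ℤ n → Vec ℤ m
lincomb M v = Vec.foldr _ _+ᵛ_ 0ᵛ (Vec.zipWith _*ᵛ_ v M)

lincomb-map : ∀ {L : Vec ℤ m → Vec ℤ m} → IsLinear L →
              (M : Vec (Vec ℤ m) n) (v : Vec ℤ n) → lincomb (Vec.map L M) v ≡ L (lincomb M v)
lincomb-map L-linear []      []      = sym preserves-0ᵛ
  where open IsLinear L-linear
lincomb-map {L = L} L-linear (x ∷ M) (c ∷ v) = begin
  c *ᵛ L x +ᵛ lincomb (Vec.map L M) v   ≡⟨ cong₂ _+ᵛ_ (sym (homogeneous c x)) (lincomb-map L-linear M v) ⟩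
  L (c *ᵛ x) +ᵛ L (lincomb M v)         ≡⟨ sym (additive (c *ᵛ x) (lincomb M v)) ⟩
  L (c *ᵛ x +ᵛ lincomb M v)             ∎
  where open IsLinear L-linear

identity : ∀ m → Vec (Vec ℤ m) m
identity zero    = []
identity (suc m) = (1ℤ ∷ 0ᵛ) ∷ Vec.map (0ℤ ∷_) (identity m)

lincomb-0∷ : (M : Vec (Vec ℤ m) n) (v : Vec ℤ n) → lincomb (Vec.map (0ℤ ∷_) M) v ≡ 0ℤ ∷ lincomb M v
lincomb-0∷ []      []      = refl
lincomb-0∷ (x ∷ M) (c ∷ v) rewrite lincomb-0∷ M v =
  cong (_∷ (c *ᵛ x +ᵛ lincomb M v)) (cong (_+ 0ℤ) (ℤ.*-zeroʳ c))

lincomb-identity : (v : Vec ℤ m) → lincomb (identity m) v ≡ v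
lincomb-identity []      = refl
lincomb-identity {suc m} (c ∷ v) = begin
  c *ᵛ (1ℤ ∷ 0ᵛ) +ᵛ lincomb (Vec.map (0ℤ ∷_) (identity m)) v
    ≡⟨ cong (c *ᵛ (1ℤ ∷ 0ᵛ) +ᵛ_) (lincomb-0∷ (identity m) v) ⟩
  (c * 1ℤ + 0ℤ) ∷ (c *ᵛ 0ᵛ +ᵛ lincomb (identity m) v)
    ≡⟨ cong₂ _∷_ (unit c) (cong₂ _+ᵛ_ (*ᵛ-zeroʳ c) (lincomb-identity v)) ⟩
  c ∷ (0ᵛ +ᵛ v)
    ≡⟨ cong (c ∷_) (+ᵛ-identityˡ v) ⟩
  c ∷ v
    ∎
  where
  unit : ∀ c → c * 1ℤ + 0ℤ ≡ c
  unit = solve-∀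

sref-linear : (α : V) → IsLinear (sref α)
sref-linear α = record { additive = additive ; homogeneous = homogeneous }
  where
  additive : ∀ x y → sref α (x +ᵛ y) ≡ sref α x +ᵛ sref α y
  additive x y = begin
    (x +ᵛ y) -ᵛ form (x +ᵛ y) α *ᵛ α        ≡⟨ cong (λ k → (x +ᵛ y) -ᵛ k *ᵛ α) (∙-distribʳ-+ᵛ x y _) ⟩
    (x +ᵛ y) -ᵛ (form x α + form y α) *ᵛ α  ≡⟨ -ᵛ-*ᵛ-distribʳ-+ (form x α) (form y α) x y α ⟩
    sref α x +ᵛ sref α y                    ∎

  homogeneous : ∀ c x → sref α (c *ᵛ x) ≡ c *ᵛ sref α x
  homogeneous c x = begin
    c *ᵛ x -ᵛ form (c *ᵛ x) α *ᵛ α  ≡⟨ cong (λ k → c *ᵛ x -ᵛ k *ᵛ α) (∙-*ᵛˡ c x _) ⟩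
    c *ᵛ x -ᵛ (c * form x α) *ᵛ α   ≡⟨ -ᵛ-*ᵛ-factor c (form x α) x α ⟩
    c *ᵛ sref α x                   ∎

apply-reflMat : ∀ α v → apply (reflMat α) v ≡ sref α v
apply-reflMat α v = begin
  apply (reflMat α) v                      ≡⟨ cong (λ M → apply M v) (Vec.tabulate-∘ (sref α) e) ⟩
  apply (Vec.map (sref α) (tabulate e)) v  ≡⟨ lincomb-map (sref-linear α) (tabulate e) v ⟩
  sref α (apply (tabulate e) v)            ≡⟨ cong (sref α) (lincomb-identity v) ⟩
  sref α v                                 ∎

apply-reflMat-· : ∀ α γ v → apply (reflMat α · reflMat γ) v ≡ sref α (sref γ v)
apply-reflMat-· α γ v = begin
  apply (Vec.map (apply (reflMat α)) (reflMat γ)) v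
    ≡⟨ cong (λ M → apply M v) (Vec.map-cong (apply-reflMat α) (reflMat γ)) ⟩
  apply (Vec.map (sref α) (reflMat γ)) v
    ≡⟨ lincomb-map (sref-linear α) (reflMat γ) v ⟩
  sref α (apply (reflMat γ) v)
    ≡⟨ cong (sref α) (apply-reflMat γ v) ⟩
  sref α (sref γ v)
    ∎

countᵇ : (A → Bool) → List A → ℕ
countᵇ p xs = length (filterᵇ p xs)

countᵇ-cong : ∀ {p q : A → Bool} xs → (∀ {x} → x ∈ xs → p x ≡ q x) → countᵇ p xs ≡ countᵇ q xs
countᵇ-cong {p = p} {q} []       p≗q = refl
countᵇ-cong {p = p} {q} (x ∷ xs) p≗q with p x | q x | p≗q (here refl) | countᵇ-cong xs (p≗q ∘ there)
... | true  | true  | refl | ih = cong suc ih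
... | false | false | refl | ih = ih

countᵇ-map : ∀ {B : Set} (p : B → Bool) (f : A → B) xs → countᵇ p (List.map f xs) ≡ countᵇ (p ∘ f) xs
countᵇ-map p f []       = refl
countᵇ-map p f (x ∷ xs) with p (f x)
... | true  = cong suc (countᵇ-map p f xs)
... | false = countᵇ-map p f xs

countᵇ-↭ : ∀ (p : A → Bool) {xs ys} → xs ↭ ys → countᵇ p xs ≡ countᵇ p ys
countᵇ-↭ p xs↭ys = ↭-length (filter-↭ (T? ∘ p) xs↭ys)

zipWith-map-diagonal : ∀ {B C : Set} (f : B → B → C) (p q : A → B) xs →
                       zipWith f (List.map p xs) (List.map q xs) ≡ List.map (λ x → f (p x) (q x)) xs
zipWith-map-diagonal f p q []       = refl
zipWith-map-diagonal f p q (x ∷ xs) = cong (_ ∷_) (zipWith-map-diagonal f p q xs)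

all-∈ : ∀ (p : A → Bool) {xs x} → T (all p xs) → x ∈ xs → T (p x)
all-∈ p {xs} all-p = ListAll.lookup (all⁺ p xs all-p)

allPairs : (A → A → Bool) → List A → Bool
allPairs p xs = all (λ x → all (p x) xs) xs

allPairs-∈ : ∀ (p : A → A → Bool) {xs x y} → T (allPairs p xs) → x ∈ xs → y ∈ xs → T (p x y)
allPairs-∈ p {xs} all-pairs x∈xs = all-∈ (p _) (all-∈ (λ x → all (p x) xs) all-pairs x∈xs)

module _ (_≟_ : DecidableEquality A) where

  remove : A → List A → Maybe (List A)
  remove x []       = nothing
  remove x (y ∷ ys) = if does (x ≟ y) then just ys else Maybe.map (y ∷_) (remove x ys)

  isPermutation : List A → List A → Bool
  isPermutation []       []      = true
  isPermutation []       (_ ∷ _) = false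
  isPermutation (x ∷ xs) ys      = maybe (isPermutation xs) false (remove x ys)

  remove-↭ : ∀ x ys {zs} → remove x ys ≡ just zs → ys ↭ x ∷ zs
  remove-↭ x (y ∷ ys) eq with x ≟ y
  ... | yes refl with refl ← eq = ↭.refl
  ... | no _ with remove x ys in removed
  ...   | just ws with refl ← eq = ↭.trans (↭.prep y (remove-↭ x ys removed)) (↭.swap y x ↭.refl)

  isPermutation-sound : ∀ xs ys → T (isPermutation xs ys) → xs ↭ ys
  isPermutation-sound []       []  _    = ↭.refl
  isPermutation-sound (x ∷ xs) ys perm with remove x ys in removed
  ... | just zs = ↭.trans (↭.prep x (isPermutation-sound xs zs perm)) (↭.↭-sym (remove-↭ x ys removed))

T-not-∨-elim : ∀ b {c} → T (not b ∨ c) → T b → T c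
T-not-∨-elim true  c _  = c
T-not-∨-elim false _ ()

T-xor⇒≡not : ∀ a {b} → T (a xor b) → a ≡ not b
T-xor⇒≡not true  {false} _ = refl
T-xor⇒≡not false {true}  _ = refl

-- sref α v = reflectBy α (cartanImage α) v by unfolding `form`.  The certificates take C α
-- as a separate argument so that evaluation computes it once per root, not once per
-- reflected vector.
cartanImage : V → V
cartanImage α = tabulate λ i → dot (Vec.lookup cartan i) α

reflectBy : V → V → V → V
reflectBy α c v = v -ᵛ (v ∙ c) *ᵛ α

reflect : V → V → V
reflect α = reflectBy α (cartanImage α)

inverts : V → V → Bool
inverts α β = isNeg (reflect α β)

flipBy : V → V → V → V
flipBy α c β = if isNeg (reflectBy α c β) then -1ℤ *ᵛ β else β

flipInversions : V → V → V
flipInversions α = flipBy α (cartanImage α)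

hasDefiniteSign : V → Bool
hasDefiniteSign x = isNeg (-1ℤ *ᵛ x) xor isNeg x

reflectionFacts : List V → V → V → Bool
reflectionFacts Φ α c = isPermutation _≟V_ (List.map (reflectBy α c) Φ) (List.map (flipBy α c) Φ)
                        ∧ all (hasDefiniteSign ∘ reflectBy α c) Φ

reflectionCertificate : List V → Bool
reflectionCertificate Φ = all (λ α → reflectionFacts Φ α (cartanImage α)) Φ

reflectionCertificate-holds : reflectionCertificate posRoots ≡ true
reflectionCertificate-holds = refl

count-inverts : ∀ {w α} Φ → (∀ v → apply w v ≡ sref α v) →
                countᵇ (λ β → isNeg (apply w β)) Φ ≡ countᵇ (inverts α) Φ
count-inverts Φ w≗sα = countᵇ-cong Φ λ {β} _ → cong isNeg (w≗sα β)

-- Φ is explicit here and below: inferring it from `certified` at Φ = posRoots would make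
-- the unifier evaluate the certificate.
module _ (Φ : List V) (certified : reflectionCertificate Φ ≡ true) where

  private
    reflectionFacts-holds : ∀ {α} → α ∈ Φ →
      T (isPermutation _≟V_ (List.map (reflect α) Φ) (List.map (flipInversions α) Φ))
      × T (all (hasDefiniteSign ∘ reflect α) Φ)
    reflectionFacts-holds = Equivalence.to T-∧ ∘ all-∈ _ (Equivalence.from T-≡ certified)

  reflect-permutes : ∀ {α} → α ∈ Φ → List.map (reflect α) Φ ↭ List.map (flipInversions α) Φ
  reflect-permutes α∈Φ = isPermutation-sound _≟V_ _ _ (proj₁ (reflectionFacts-holds α∈Φ))

  isNeg-negate-reflect : ∀ {α β} → α ∈ Φ → β ∈ Φ →
                         isNeg (-1ℤ *ᵛ reflect α β) ≡ not (isNeg (reflect α β))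
  isNeg-negate-reflect α∈Φ β∈Φ = T-xor⇒≡not _ (all-∈ _ (proj₂ (reflectionFacts-holds α∈Φ)) β∈Φ)

  inverts-flipInversions : ∀ {α} γ {β} → α ∈ Φ → β ∈ Φ →
                           inverts α (flipInversions γ β) ≡ inverts γ β xor inverts α β
  inverts-flipInversions {α} γ {β} α∈Φ β∈Φ with inverts γ β
  ... | false = refl
  ... | true  = begin
    isNeg (sref α (-1ℤ *ᵛ β))   ≡⟨ cong isNeg (IsLinear.homogeneous (sref-linear α) -1ℤ β) ⟩
    isNeg (-1ℤ *ᵛ sref α β)     ≡⟨ isNeg-negate-reflect α∈Φ β∈Φ ⟩
    not (inverts α β)           ∎

  count-inverts-· : ∀ {w α γ} → (∀ v → apply w v ≡ sref α (sref γ v)) → α ∈ Φ → γ ∈ Φ →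
                    countᵇ (λ β → isNeg (apply w β)) Φ ≡ countᵇ (λ β → inverts γ β xor inverts α β) Φ
  count-inverts-· {w} {α} {γ} w≗sαsγ α∈Φ γ∈Φ = begin
    countᵇ (λ β → isNeg (apply w β)) Φ                     ≡⟨ countᵇ-cong Φ (λ {β} _ → cong isNeg (w≗sαsγ β)) ⟩
    countᵇ (inverts α ∘ reflect γ) Φ                       ≡⟨ countᵇ-map (inverts α) (reflect γ) Φ ⟨
    countᵇ (inverts α) (List.map (reflect γ) Φ)            ≡⟨ countᵇ-↭ (inverts α) (reflect-permutes γ∈Φ) ⟩
    countᵇ (inverts α) (List.map (flipInversions γ) Φ)     ≡⟨ countᵇ-map (inverts α) (flipInversions γ) Φ ⟩
    countᵇ (inverts α ∘ flipInversions γ) Φ                ≡⟨ countᵇ-cong Φ (inverts-flipInversions γ α∈Φ) ⟩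
    countᵇ (λ β → inverts γ β xor inverts α β) Φ          ∎

inversionMask : List V → V → V → List Bool
inversionMask Φ α c = List.map (isNeg ∘ reflectBy α c) Φ

inversionTable : List V → List (V × List Bool)
inversionTable Φ = List.map (λ α → α , inversionMask Φ α (cartanImage α)) Φ

descent⇒belowᵇ : V × List Bool → V × List Bool → Bool
descent⇒belowᵇ (α , Nα) (γ , Nγ) =
  not (countᵇ id (zipWith _xor_ Nγ Nα) <ᵇ countᵇ id Nα) ∨ ⌊ all? (0ℤ ≤?_) (α -ᵛ γ) ⌋

descentCertificate : List V → Bool
descentCertificate Φ = allPairs descent⇒belowᵇ (inversionTable Φ)

descentCertificate-holds : descentCertificate posRoots ≡ true
descentCertificate-holds = refl

module _ (Φ : List V) (certified : descentCertificate Φ ≡ true) where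

  descent⇒nonnegative : ∀ {α γ} → α ∈ Φ → γ ∈ Φ →
    countᵇ (λ β → inverts γ β xor inverts α β) Φ < countᵇ (inverts α) Φ → All (0ℤ ≤_) (α -ᵛ γ)
  descent⇒nonnegative {α} {γ} α∈Φ γ∈Φ descent =
    toWitness (T-not-∨-elim _ pair-checked (ℕ.<⇒<ᵇ descentᵇ))
    where
    mask : V → List Bool
    mask δ = List.map (inverts δ) Φ

    row : ∀ {δ} → δ ∈ Φ → (δ , mask δ) ∈ inversionTable Φ
    row = ∈-map⁺ (λ δ → δ , mask δ)

    pair-checked : T (descent⇒belowᵇ (α , mask α) (γ , mask γ))
    pair-checked = allPairs-∈ descent⇒belowᵇ (Equivalence.from T-≡ certified) (row α∈Φ) (row γ∈Φ)

    count-xor : countᵇ id (zipWith _xor_ (mask γ) (mask α))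
              ≡ countᵇ (λ β → inverts γ β xor inverts α β) Φ
    count-xor = ≡-trans (cong (countᵇ id) (zipWith-map-diagonal _xor_ (inverts γ) (inverts α) Φ))
                        (countᵇ-map id _ Φ)

    descentᵇ : countᵇ id (zipWith _xor_ (mask γ) (mask α)) < countᵇ id (mask α)
    descentᵇ = subst₂ _<_ (sym count-xor) (sym (countᵇ-map id (inverts α) Φ)) descent

<B⇒ℓ< : ∀ {u v} → u <B v → ℓ u < ℓ v
<B⇒ℓ< (step u β _ ℓu<ℓv) = ℓu<ℓv
<B⇒ℓ< (trans u<v v<w)    = ℕ.<-trans (<B⇒ℓ< u<v) (<B⇒ℓ< v<w)

corollary4p8 : (r t : Refl) → InD r t → r ⪯ t
corollary4p8 r t tr<t =
  lookup⁺ (descent⇒nonnegative posRoots descentCertificate-holds (proj₂ t) (proj₂ r) shorter)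
  where
  shorter : countᵇ (λ β → inverts (proj₁ r) β xor inverts (proj₁ t) β) posRoots
            < countᵇ (inverts (proj₁ t)) posRoots
  shorter = subst₂ _<_
    (count-inverts-· posRoots reflectionCertificate-holds
                     (apply-reflMat-· (proj₁ t) (proj₁ r)) (proj₂ t) (proj₂ r))
    (count-inverts posRoots (apply-reflMat (proj₁ t)))
    (<B⇒ℓ< tr<t)
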